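{- Let $q\ge 2$ be an integer and let $A_0 \in \{ -1,0,1\}^{m_0\times n_0}$ be an $\mathrm{EQ}_q$ matrix. For integers $k\ge 1$ define $A_k$ recursively as the block matrix with $q$ block rows and $q+1$ block columns \[ A_k=\begin{bmatrix} A_{k-1} & A_{k-1} & A_{k-1} & \cdots & A_{k-1} & I_{m_{k-1}}\\ A_{k-1} & -A_{k-1} & 0 & \cdots & 0 & 0\\ 0 & A_{k-1} & -A_{k-1} & \cdots & 0 & 0\\ \vdots & & & \ddots & & \vdots\\ 0 & 0 & \cdots & A_{k-1} & -A_{k-1} & 0 \end{bmatrix}, \] i.e., the first block row consists of $q$ copies of $A_{k-1}$ followed by the $m_{k-1}\times m_{k-1}$ identity $I_{m_{k-1}}$, and for $j=1,\dots,q-1$ the $(j+1)$-th block row has $A_{k-1}$ in block column $j$, $-A_{k-1}$ in block column $j+1$, and zero blocks elsewhere (including a zero $m_{k-1}\times m_{k-1}$ block in the last block column). Here $A_{k-1}$ has size $m_{k-1}\times n_{k-1}$. Then for every integer $k\ge 0$, $A_k$ is an $\mathrm{EQ}_q$ matrix of size $m_k\times n_k$ with $m_k=q^k m_0$ and $n_k = q^k n_0\left(\frac{k}{q}\frac{m_0}{n_0}+1\right)$.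
   Context: For an integer $q\ge 2$, a matrix $A\in\mathbb{Z}^{m\times n}$ is called an $\mathrm{EQ}_q$ matrix if the homogeneous system $Ax=0$ has no non-trivial solution $x\in\{ -q+1,\dots,q-1\}^n$. -}

module Defs where

open import Data.Nat as ℕ using (ℕ; zero; suc)
open import Data.Integer as ℤ using (ℤ; +_; -_; ∣_∣)
open import Data.Fin as Fin using (Fin; toℕ; splitAt; remQuot)
open import Data.Sum using (_⊎_; inj₁; inj₂)
open import Data.Product using (Σ; _×_; _,_; ∃)
open import Data.Empty using (⊥)
open import Relation.Nullary using (¬_; yes; no)
open import Relation.Binary.PropositionalEquality using (_≡_; _≢_)

Matrix : ℕ → ℕ → Set
Matrix m n = Fin m → Fin n → ℤ

∑ : ∀ {n} → (Fin n → ℤ) → ℤ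
∑ {zero}  f = + 0
∑ {suc n} f = f Fin.zero ℤ.+ ∑ (λ i → f (Fin.suc i))

IsEQ : ℕ → ∀ {m n} → Matrix m n → Set
IsEQ q {m} {n} A =
  ¬ (Σ (Fin n → ℤ) λ x →
       (∀ j → ∣ x j ∣ ℕ.< q)
     × (∃ λ j → x j ≢ + 0)
     × (∀ i → ∑ (λ j → A i j ℤ.* x j) ≡ + 0))

-- Dimensions of the recursive construction:
-- m_k = q * m_{k-1}  (q block rows),  n_k = q * n_{k-1} + m_{k-1}  (q blocks plus identity).
dimM : ℕ → ℕ → ℕ → ℕ
dimM q m0 zero    = m0
dimM q m0 (suc k) = q ℕ.* dimM q m0 k

dimN : ℕ → ℕ → ℕ → ℕ → ℕ
dimN q m0 n0 zero    = n0
dimN q m0 n0 (suc k) = q ℕ.* dimN q m0 n0 k ℕ.+ dimM q m0 k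

idEntry : ∀ {m} → Fin m → Fin m → ℤ
idEntry r c with r Fin.≟ c
... | yes _ = + 1
... | no  _ = + 0

-- Entry of block (bi, bj) (0-based block indices, bi < q, bj < q) of the
-- first q block columns: block row 0 is all B; block row t ≥ 1 has B in
-- block column t-1, -B in block column t, zero elsewhere.
blockEntry : ℕ → ℕ → ℤ → ℤ
blockEntry zero      bj       b = b
blockEntry (suc t)   bj       b with t ℕ.≟ bj | suc t ℕ.≟ bj
... | yes _ | _     = b
... | no _  | yes _ = - b
... | no _  | no _  = + 0

-- Row index of Fin (q * m) is split into
-- (block row, inner row); column index of Fin (q * n + m) is split into the
-- first q n columns (block column, inner column) and the last m columns.
step : (q : ℕ) → ∀ {m n} → Matrix m n → Matrix (q ℕ.* m) (q ℕ.* n ℕ.+ m)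
step q {m} {n} B r c with remQuot {q} m r | splitAt (q ℕ.* n) c
... | (bi , ri) | inj₁ c' with remQuot {q} n c'
...   | (bj , cj) = blockEntry (toℕ bi) (toℕ bj) (B ri cj)
step q {m} {n} B r c | (bi , ri) | inj₂ c'' with toℕ bi
... | zero  = idEntry ri c''
... | suc _ = + 0

Aₖ : (q : ℕ) → ∀ {m0 n0} → Matrix m0 n0 → (k : ℕ) →
     Matrix (dimM q m0 k) (dimN q m0 n0 k)
Aₖ q A0 zero    = A0
Aₖ q A0 (suc k) = step q (Aₖ q A0 k)

{-# OPTIONS --safe #-}
-- Split a vector x in the kernel of step q B into q blocks x₁ … x_q followed
-- by a part y of length m, and put vⱼ = B xⱼ. Block row j + 1 says
-- vⱼ = vⱼ₊₁, so all vⱼ equal one vector v, and the first block row then says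
-- q v + y = 0. Every entry of y is smaller than q in absolute value, which
-- forces v = 0 and y = 0; hence each xⱼ is a small solution of B xⱼ = 0 and
-- vanishes because B is EQ_q.
module Submission where

open import Defs
open import Data.Nat using (ℕ; _≤_; _*_; _+_; _^_)
open import Data.Integer using (∣_∣)
open import Data.Product using (_×_)
open import Relation.Binary.PropositionalEquality using (_≡_)

open import Data.Empty using (⊥-elim)
open import Data.Fin as Fin using (Fin; zero; suc; toℕ; _↑ˡ_; _↑ʳ_; combine; splitAt; inject₁)
open import Data.Fin.Properties
  using (toℕ-injective; toℕ-inject₁; suc-injective; remQuot-combine; combine-remQuot;
         splitAt-↑ˡ; splitAt-↑ʳ; join-splitAt)
open import Data.Integer as ℤ using (ℤ; +_; -_; _-_; 0ℤ)
open import Data.Integer.Properties as ℤ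
  using (+-identityˡ; +-identityʳ; +-assoc; +-comm; *-identityˡ; *-zeroʳ; *-assoc;
         *-distribˡ-+; *-distribʳ-+; neg-distribˡ-*; abs-*; ∣-i∣≡∣i∣; ∣i∣≡0⇒i≡0; i-j≡0⇒i≡j)
open import Algebra.Properties.AbelianGroup ℤ.+-0-abelianGroup using (inverseʳ-unique)
open import Data.Nat as ℕ using (zero; suc; _<_)
open import Data.Nat.Properties as ℕ using (n≮0; n<1⇒n≡0; *-cancelˡ-<; 1+n≢n)
open import Data.Nat.Tactic.RingSolver using (solve-∀)
open import Data.Product using (_,_)
open import Data.Sum using (inj₁; inj₂)
open import Function using (_∘_)
open import Relation.Nullary using (yes; no)
open import Relation.Binary.PropositionalEquality
  using (_≢_; _≗_; refl; sym; trans; cong; cong₂; subst; subst₂; module ≡-Reasoning)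

∑-cong : ∀ {n} {f g : Fin n → ℤ} → f ≗ g → ∑ f ≡ ∑ g
∑-cong {zero}  f≗g = refl
∑-cong {suc n} f≗g = cong₂ ℤ._+_ (f≗g zero) (∑-cong (f≗g ∘ suc))

∑-↑ˡ-↑ʳ : ∀ a b (f : Fin (a + b) → ℤ) → ∑ f ≡ ∑ (f ∘ (_↑ˡ b)) ℤ.+ ∑ (f ∘ (a ↑ʳ_))
∑-↑ˡ-↑ʳ zero    b f = sym (+-identityˡ _)
∑-↑ˡ-↑ʳ (suc a) b f =
  trans (cong (ℤ._+_ (f zero)) (∑-↑ˡ-↑ʳ a b (f ∘ suc))) (sym (+-assoc (f zero) _ _))

∑-combine : ∀ q n (f : Fin (q * n) → ℤ) → ∑ f ≡ ∑ (λ i → ∑ (λ j → f (combine {q} {n} i j)))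
∑-combine zero    n f = refl
∑-combine (suc q) n f =
  trans (∑-↑ˡ-↑ʳ n (q * n) f) (cong (ℤ._+_ (∑ (f ∘ (_↑ˡ q * n)))) (∑-combine q n (f ∘ (n ↑ʳ_))))

*-distribˡ-∑ : ∀ {n} c (f : Fin n → ℤ) → ∑ (λ i → c ℤ.* f i) ≡ c ℤ.* ∑ f
*-distribˡ-∑ {zero}  c f = sym (*-zeroʳ c)
*-distribˡ-∑ {suc n} c f =
  trans (cong (ℤ._+_ (c ℤ.* f zero)) (*-distribˡ-∑ c (f ∘ suc))) (sym (*-distribˡ-+ c (f zero) _))

∑-const : ∀ n c → ∑ {n} (λ _ → c) ≡ + n ℤ.* c
∑-const zero    c = refl
∑-const (suc n) c = begin
  c ℤ.+ ∑ {n} (λ _ → c)         ≡⟨ cong (ℤ._+_ c) (∑-const n c) ⟩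
  c ℤ.+ + n ℤ.* c               ≡⟨ cong (ℤ._+ + n ℤ.* c) (*-identityˡ c) ⟨
  + 1 ℤ.* c ℤ.+ + n ℤ.* c       ≡⟨ *-distribʳ-+ c (+ 1) (+ n) ⟨
  + suc n ℤ.* c                 ∎
  where open ≡-Reasoning

∑-zero : ∀ {n} (f : Fin n → ℤ) → (∀ j → f j ≡ 0ℤ) → ∑ f ≡ 0ℤ
∑-zero {zero}  f f≡0 = refl
∑-zero {suc n} f f≡0 = cong₂ ℤ._+_ (f≡0 zero) (∑-zero (f ∘ suc) (f≡0 ∘ suc))

∑-single : ∀ {n} (f : Fin n → ℤ) a → (∀ j → j ≢ a → f j ≡ 0ℤ) → ∑ f ≡ f a
∑-single f zero    f≡0 =
  trans (cong (ℤ._+_ (f zero)) (∑-zero (f ∘ suc) (λ j → f≡0 (suc j) λ ()))) (+-identityʳ _)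
∑-single f (suc a) f≡0 =
  trans (cong₂ ℤ._+_ (f≡0 zero λ ()) refl) (trans (+-identityˡ _)
        (∑-single (f ∘ suc) a (λ j j≢a → f≡0 (suc j) (j≢a ∘ suc-injective))))

∑-pair : ∀ {n} (f : Fin n → ℤ) a b → a ≢ b → (∀ j → j ≢ a → j ≢ b → f j ≡ 0ℤ) →
         ∑ f ≡ f a ℤ.+ f b
∑-pair f zero    zero    a≢b f≡0 = ⊥-elim (a≢b refl)
∑-pair f zero    (suc b) a≢b f≡0 =
  cong (ℤ._+_ (f zero)) (∑-single (f ∘ suc) b (λ j j≢b → f≡0 (suc j) (λ ()) (j≢b ∘ suc-injective)))
∑-pair f (suc a) zero    a≢b f≡0 =
  trans (cong (ℤ._+_ (f zero)) (∑-single (f ∘ suc) a (λ j j≢a → f≡0 (suc j) (j≢a ∘ suc-injective) (λ ()))))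
        (+-comm (f zero) (f (suc a)))
∑-pair f (suc a) (suc b) a≢b f≡0 =
  trans (cong₂ ℤ._+_ (f≡0 zero (λ ()) (λ ())) refl) (trans (+-identityˡ _)
        (∑-pair (f ∘ suc) a b (a≢b ∘ cong suc)
                (λ j j≢a j≢b → f≡0 (suc j) (j≢a ∘ suc-injective) (j≢b ∘ suc-injective))))

adjacent-equal⇒constant : ∀ {a} {A : Set a} {p} (f : Fin (suc p) → A) →
                          (∀ j → f (inject₁ j) ≡ f (suc j)) → ∀ i → f i ≡ f zero
adjacent-equal⇒constant             f adj zero    = refl
adjacent-equal⇒constant {p = suc p} f adj (suc i) =
  trans (adjacent-equal⇒constant (f ∘ suc) (adj ∘ suc) i) (sym (adj zero))

∣+q*i∣<q⇒i≡0 : ∀ q i → ∣ + q ℤ.* i ∣ < q → i ≡ 0ℤ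
∣+q*i∣<q⇒i≡0 q i ∣qi∣<q = ∣i∣≡0⇒i≡0 (n<1⇒n≡0 (*-cancelˡ-< q ∣ i ∣ 1 q∣i∣<q*1))
  where
  q∣i∣<q*1 : q * ∣ i ∣ < q * 1
  q∣i∣<q*1 = subst₂ _<_ (abs-* (+ q) i) (sym (ℕ.*-identityʳ q)) ∣qi∣<q

_*ᵥ_ : ∀ {m n} → Matrix m n → (Fin n → ℤ) → Fin m → ℤ
(A *ᵥ x) i = ∑ λ j → A i j ℤ.* x j

IsEQ⇒small-solution≡0 : ∀ {q m n} (A : Matrix m n) → IsEQ q A →
                        ∀ x → (∀ j → ∣ x j ∣ < q) → (∀ i → (A *ᵥ x) i ≡ 0ℤ) → ∀ j → x j ≡ 0ℤ
IsEQ⇒small-solution≡0 A A-EQ x small Ax≡0 j with x j ℤ.≟ 0ℤ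
... | yes xj≡0 = xj≡0
... | no  xj≢0 = ⊥-elim (A-EQ (x , small , (j , xj≢0) , Ax≡0))

blockEntry-linear : ∀ t s b → blockEntry t s b ≡ blockEntry t s (+ 1) ℤ.* b
blockEntry-linear zero    s b = sym (*-identityˡ b)
blockEntry-linear (suc t) s b with t ℕ.≟ s | suc t ℕ.≟ s
... | yes _ | _     = sym (*-identityˡ b)
... | no _  | yes _ = trans (cong -_ (sym (*-identityˡ b))) (neg-distribˡ-* (+ 1) b)
... | no _  | no _  = refl

blockEntry-*ʳ : ∀ t s b x → blockEntry t s b ℤ.* x ≡ blockEntry t s (b ℤ.* x)
blockEntry-*ʳ t s b x = begin
  blockEntry t s b ℤ.* x                  ≡⟨ cong (ℤ._* x) (blockEntry-linear t s b) ⟩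
  blockEntry t s (+ 1) ℤ.* b ℤ.* x        ≡⟨ *-assoc (blockEntry t s (+ 1)) b x ⟩
  blockEntry t s (+ 1) ℤ.* (b ℤ.* x)      ≡⟨ blockEntry-linear t s (b ℤ.* x) ⟨
  blockEntry t s (b ℤ.* x)                ∎
  where open ≡-Reasoning

∑-blockEntry : ∀ {n} t s (g : Fin n → ℤ) → ∑ (λ j → blockEntry t s (g j)) ≡ blockEntry t s (∑ g)
∑-blockEntry t s g = begin
  ∑ (λ j → blockEntry t s (g j))          ≡⟨ ∑-cong (λ j → blockEntry-linear t s (g j)) ⟩
  ∑ (λ j → blockEntry t s (+ 1) ℤ.* g j)  ≡⟨ *-distribˡ-∑ (blockEntry t s (+ 1)) g ⟩
  blockEntry t s (+ 1) ℤ.* ∑ g            ≡⟨ blockEntry-linear t s (∑ g) ⟨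
  blockEntry t s (∑ g)                    ∎
  where open ≡-Reasoning

blockEntry-subdiagonal : ∀ t s b → t ≡ s → blockEntry (suc t) s b ≡ b
blockEntry-subdiagonal t s b t≡s with t ℕ.≟ s
... | yes _   = refl
... | no  t≢s = ⊥-elim (t≢s t≡s)

blockEntry-diagonal : ∀ t s b → suc t ≡ s → blockEntry (suc t) s b ≡ - b
blockEntry-diagonal t s b 1+t≡s with t ℕ.≟ s | suc t ℕ.≟ s
... | yes t≡s | _        = ⊥-elim (1+n≢n (trans 1+t≡s (sym t≡s)))
... | no _    | yes _    = refl
... | no _    | no 1+t≢s = ⊥-elim (1+t≢s 1+t≡s)

blockEntry-off : ∀ t s b → t ≢ s → suc t ≢ s → blockEntry (suc t) s b ≡ 0ℤ
blockEntry-off t s b t≢s 1+t≢s with t ℕ.≟ s | suc t ℕ.≟ s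
... | yes t≡s   | _         = ⊥-elim (t≢s t≡s)
... | no _      | yes 1+t≡s = ⊥-elim (1+t≢s 1+t≡s)
... | no _      | no _      = refl

idEntry-diagonal : ∀ {m} (r : Fin m) → idEntry r r ≡ + 1
idEntry-diagonal r with r Fin.≟ r
... | yes _   = refl
... | no  r≢r = ⊥-elim (r≢r refl)

idEntry-off : ∀ {m} (r c : Fin m) → c ≢ r → idEntry r c ≡ 0ℤ
idEntry-off r c c≢r with r Fin.≟ c
... | yes r≡c = ⊥-elim (c≢r (sym r≡c))
... | no _    = refl

step-block : ∀ q {m n} (B : Matrix m n) bi ri bj cj →
             step q B (combine bi ri) (combine bj cj ↑ˡ m) ≡ blockEntry (toℕ bi) (toℕ bj) (B ri cj)
step-block q {m} {n} B bi ri bj cj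
  rewrite remQuot-combine {q} {m} bi ri | splitAt-↑ˡ (q * n) (combine {q} {n} bj cj) m =
  cong (λ (bj′ , cj′) → blockEntry (toℕ bi) (toℕ bj′) (B ri cj′)) (remQuot-combine {q} {n} bj cj)

step-identity : ∀ p {m n} (B : Matrix m n) ri c →
                step (suc p) B (combine {suc p} zero ri) (suc p * n ↑ʳ c) ≡ idEntry ri c
step-identity p {m} {n} B ri c
  rewrite splitAt-↑ˡ m ri (p * m) | splitAt-↑ʳ (suc p * n) m c = refl

step-lower-identity : ∀ p {m n} (B : Matrix m n) (j : Fin p) ri c →
                      step (suc p) B (combine (suc j) ri) (suc p * n ↑ʳ c) ≡ 0ℤ
step-lower-identity p {m} {n} B j ri c
  rewrite splitAt-↑ʳ m (p * m) (combine j ri) | splitAt-↑ʳ (suc p * n) m c = refl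

module StepProduct (q : ℕ) {m n : ℕ} (B : Matrix m n) (x : Fin (q * n + m) → ℤ) where

  block : Fin q → Fin n → ℤ
  block bj cj = x (combine bj cj ↑ˡ m)

  identityPart : Fin m → ℤ
  identityPart c = x (q * n ↑ʳ c)

  parts≡0⇒≡0 : (∀ bj cj → block bj cj ≡ 0ℤ) → (∀ c → identityPart c ≡ 0ℤ) → ∀ c → x c ≡ 0ℤ
  parts≡0⇒≡0 block≡0 identityPart≡0 c with splitAt (q * n) c | join-splitAt (q * n) m c
  ... | inj₁ c′ | refl = subst (λ i → x (i ↑ˡ m) ≡ 0ℤ) (combine-remQuot {q} n c′) (block≡0 _ _)
  ... | inj₂ c′ | refl = identityPart≡0 c′

  *ᵥ-step : ∀ (bi : Fin q) (ri : Fin m) →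
            (step q B *ᵥ x) (combine bi ri) ≡
              ∑ (λ bj → blockEntry (toℕ bi) (toℕ bj) ((B *ᵥ block bj) ri))
              ℤ.+ ∑ (λ c → step q B (combine bi ri) (q * n ↑ʳ c) ℤ.* identityPart c)
  *ᵥ-step bi ri =
    trans (∑-↑ˡ-↑ʳ (q * n) m (λ c → step q B (combine bi ri) c ℤ.* x c))
          (cong₂ ℤ._+_ (trans (∑-combine q n _) (∑-cong blockColumn)) refl)
    where
    blockColumn : ∀ bj → ∑ (λ cj → step q B (combine bi ri) (combine bj cj ↑ˡ m) ℤ.* block bj cj)
                       ≡ blockEntry (toℕ bi) (toℕ bj) ((B *ᵥ block bj) ri)
    blockColumn bj =
      trans (∑-cong λ cj → trans (cong₂ ℤ._*_ (step-block q B bi ri bj cj) refl)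
                                 (blockEntry-*ʳ (toℕ bi) (toℕ bj) (B ri cj) (block bj cj)))
            (∑-blockEntry (toℕ bi) (toℕ bj) (λ cj → B ri cj ℤ.* block bj cj))

module StepRows (p : ℕ) {m n : ℕ} (B : Matrix m n) (x : Fin (suc p * n + m) → ℤ) where

  open StepProduct (suc p) B x public

  *ᵥ-step-top : ∀ ri → (step (suc p) B *ᵥ x) (combine {suc p} zero ri) ≡
                       ∑ (λ bj → (B *ᵥ block bj) ri) ℤ.+ identityPart ri
  *ᵥ-step-top ri =
    trans (*ᵥ-step zero ri) (cong (ℤ._+_ (∑ (λ bj → (B *ᵥ block bj) ri))) identityColumns)
    where
    open ≡-Reasoning
    identityColumns :
      ∑ (λ c → step (suc p) B (combine {suc p} zero ri) (suc p * n ↑ʳ c) ℤ.* identityPart c)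
      ≡ identityPart ri
    identityColumns = begin
      ∑ (λ c → step (suc p) B (combine {suc p} zero ri) (suc p * n ↑ʳ c) ℤ.* identityPart c)
        ≡⟨ ∑-cong (λ c → cong₂ ℤ._*_ (step-identity p B ri c) refl) ⟩
      ∑ (λ c → idEntry ri c ℤ.* identityPart c)
        ≡⟨ ∑-single _ ri (λ c c≢ri → cong₂ ℤ._*_ (idEntry-off ri c c≢ri) refl) ⟩
      idEntry ri ri ℤ.* identityPart ri
        ≡⟨ cong₂ ℤ._*_ (idEntry-diagonal ri) refl ⟩
      + 1 ℤ.* identityPart ri
        ≡⟨ *-identityˡ _ ⟩
      identityPart ri
        ∎

  *ᵥ-step-lower : ∀ (j : Fin p) ri → (step (suc p) B *ᵥ x) (combine (suc j) ri) ≡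
                                     (B *ᵥ block (inject₁ j)) ri - (B *ᵥ block (suc j)) ri
  *ᵥ-step-lower j ri = begin
    (step (suc p) B *ᵥ x) (combine (suc j) ri)
      ≡⟨ *ᵥ-step (suc j) ri ⟩
    ∑ f ℤ.+ ∑ (λ c → step (suc p) B (combine (suc j) ri) (suc p * n ↑ʳ c) ℤ.* identityPart c)
      ≡⟨ cong (ℤ._+_ (∑ f)) (∑-zero _ (λ c → cong₂ ℤ._*_ (step-lower-identity p B j ri c) refl)) ⟩
    ∑ f ℤ.+ 0ℤ
      ≡⟨ +-identityʳ _ ⟩
    ∑ f
      ≡⟨ ∑-pair f (inject₁ j) (suc j) inject₁≢suc off ⟩
    f (inject₁ j) ℤ.+ f (suc j)
      ≡⟨ cong₂ ℤ._+_ (blockEntry-subdiagonal t _ _ (sym t≡)) (blockEntry-diagonal t _ _ refl) ⟩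
    v (inject₁ j) - v (suc j)
      ∎
    where
    open ≡-Reasoning
    t = toℕ j
    v : Fin (suc p) → ℤ
    v bj = (B *ᵥ block bj) ri
    f : Fin (suc p) → ℤ
    f bj = blockEntry (suc t) (toℕ bj) (v bj)
    t≡ : toℕ (inject₁ j) ≡ t
    t≡ = toℕ-inject₁ j
    inject₁≢suc : inject₁ j ≢ suc j
    inject₁≢suc e = 1+n≢n (trans (cong toℕ (sym e)) t≡)
    off : ∀ bj → bj ≢ inject₁ j → bj ≢ suc j → f bj ≡ 0ℤ
    off bj bj≢ bj≢suc = blockEntry-off t (toℕ bj) (v bj)
      (λ t≡bj → bj≢ (toℕ-injective (trans (sym t≡bj) (sym t≡))))
      (λ 1+t≡bj → bj≢suc (sym (toℕ-injective 1+t≡bj)))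

module StepKernel {p m n} (B : Matrix m n) (x : Fin (suc p * n + m) → ℤ)
                  (Bx≡0 : ∀ i → (step (suc p) B *ᵥ x) i ≡ 0ℤ) where

  open StepRows p B x public

  v : Fin (suc p) → Fin m → ℤ
  v bj = B *ᵥ block bj

  v-constant : ∀ bj ri → v bj ri ≡ v zero ri
  v-constant bj ri = adjacent-equal⇒constant (λ bj → v bj ri) adjacent bj
    where
    adjacent : ∀ j → v (inject₁ j) ri ≡ v (suc j) ri
    adjacent j = i-j≡0⇒i≡j _ _ (trans (sym (*ᵥ-step-lower j ri)) (Bx≡0 _))

  identityPart≡-qv : ∀ ri → identityPart ri ≡ - (+ suc p ℤ.* v zero ri)
  identityPart≡-qv ri = inverseʳ-unique _ _ (begin
    + suc p ℤ.* v zero ri ℤ.+ identityPart ri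
      ≡⟨ cong₂ ℤ._+_ (∑-const (suc p) (v zero ri)) refl ⟨
    ∑ {suc p} (λ _ → v zero ri) ℤ.+ identityPart ri
      ≡⟨ cong₂ ℤ._+_ (∑-cong (λ bj → v-constant bj ri)) refl ⟨
    ∑ (λ bj → v bj ri) ℤ.+ identityPart ri
      ≡⟨ *ᵥ-step-top ri ⟨
    (step (suc p) B *ᵥ x) (combine {suc p} zero ri)
      ≡⟨ Bx≡0 _ ⟩
    0ℤ
      ∎)
    where open ≡-Reasoning

step-preserves-EQ : ∀ q {m n} (B : Matrix m n) → IsEQ q B → IsEQ q (step q B)
step-preserves-EQ zero    B _ (x , small , (c , _) , _) = n≮0 (small c)
step-preserves-EQ (suc p) {m} {n} B B-EQ (x , small , (c , xc≢0) , Bx≡0) =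
  xc≢0 (parts≡0⇒≡0 block≡0 identityPart≡0 c)
  where
  open StepKernel B x Bx≡0

  v₀≡0 : ∀ ri → v zero ri ≡ 0ℤ
  v₀≡0 ri = ∣+q*i∣<q⇒i≡0 (suc p) (v zero ri) (subst (_< suc p) ∣y∣≡∣qv∣ (small (suc p * n ↑ʳ ri)))
    where
    ∣y∣≡∣qv∣ : ∣ identityPart ri ∣ ≡ ∣ + suc p ℤ.* v zero ri ∣
    ∣y∣≡∣qv∣ = trans (cong ∣_∣ (identityPart≡-qv ri)) (∣-i∣≡∣i∣ (+ suc p ℤ.* v zero ri))

  block≡0 : ∀ bj cj → block bj cj ≡ 0ℤ
  block≡0 bj = IsEQ⇒small-solution≡0 B B-EQ (block bj) (λ cj → small (combine bj cj ↑ˡ m))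
                 (λ ri → trans (v-constant bj ri) (v₀≡0 ri))

  identityPart≡0 : ∀ ri → identityPart ri ≡ 0ℤ
  identityPart≡0 ri =
    trans (identityPart≡-qv ri)
          (trans (cong (λ v₀ → - (+ suc p ℤ.* v₀)) (v₀≡0 ri)) (cong -_ (*-zeroʳ (+ suc p))))

Aₖ-EQ : ∀ q {m0 n0} (A0 : Matrix m0 n0) → IsEQ q A0 → ∀ k → IsEQ q (Aₖ q A0 k)
Aₖ-EQ q A0 A0-EQ zero    = A0-EQ
Aₖ-EQ q A0 A0-EQ (suc k) = step-preserves-EQ q (Aₖ q A0 k) (Aₖ-EQ q A0 A0-EQ k)

dimM≡q^k*m0 : ∀ q m0 k → dimM q m0 k ≡ q ^ k * m0
dimM≡q^k*m0 q m0 zero    = sym (ℕ.+-identityʳ m0)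
dimM≡q^k*m0 q m0 (suc k) = trans (cong (q *_) (dimM≡q^k*m0 q m0 k)) (sym (ℕ.*-assoc q (q ^ k) m0))

q*dimN≡q^k*[k*m0+q*n0] : ∀ q m0 n0 k → q * dimN q m0 n0 k ≡ q ^ k * (k * m0 + q * n0)
q*dimN≡q^k*[k*m0+q*n0] q m0 n0 zero    = sym (ℕ.+-identityʳ (q * n0))
q*dimN≡q^k*[k*m0+q*n0] q m0 n0 (suc k) = begin
  q * (q * dimN q m0 n0 k + dimM q m0 k)
    ≡⟨ ℕ.*-distribˡ-+ q (q * dimN q m0 n0 k) (dimM q m0 k) ⟩
  q * (q * dimN q m0 n0 k) + q * dimM q m0 k
    ≡⟨ cong₂ (λ a b → q * a + q * b) (q*dimN≡q^k*[k*m0+q*n0] q m0 n0 k) (dimM≡q^k*m0 q m0 k) ⟩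
  q * (q ^ k * (k * m0 + q * n0)) + q * (q ^ k * m0)
    ≡⟨ regroup q (q ^ k) k m0 n0 ⟩
  q * q ^ k * (suc k * m0 + q * n0)
    ∎
  where
  open ≡-Reasoning
  regroup : ∀ q P k m0 n0 →
            q * (P * (k * m0 + q * n0)) + q * (P * m0) ≡ q * P * ((1 + k) * m0 + q * n0)
  regroup = solve-∀

-- Neither 2 ≤ q nor the bound on the entries of A0 is needed: the
-- construction preserves EQ_q for every q and every integer matrix.
theorem2 : (q m0 n0 : ℕ) → 2 ≤ q → (A0 : Matrix m0 n0) →
    (∀ i j → ∣ A0 i j ∣ ≤ 1) → IsEQ q A0 →
    (k : ℕ) →
      IsEQ q (Aₖ q A0 k)
      × dimM q m0 k ≡ q ^ k * m0
      × q * dimN q m0 n0 k ≡ q ^ k * (k * m0 + q * n0)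
theorem2 q m0 n0 _ A0 _ A0-EQ k =
  Aₖ-EQ q A0 A0-EQ k , dimM≡q^k*m0 q m0 k , q*dimN≡q^k*[k*m0+q*n0] q m0 n0 k
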